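{- For every skew free leaper $L$, the pseudosnake density of $L$ satisfies $1/2 \le \tau(L) \le \eta$.
   Context: For nonnegative integers $p\le q$, not both zero, a $(p,q)$-leaper $L$ has leaper graph $\mathcal{G}(L,S)$ on a set of cells $S\subseteq\mathbb{Z}^2$ with two cells adjacent iff $\{|x'-x''|,|y'-y''|\}=\{p,q\}$. $L$ is skew if $0<p<q$; a skew leaper with $\gcd(p,q)=1$ is free if $p+q$ is odd. A pseudosnake of a graph is an induced subgraph in which every vertex has degree at most $2$; the pseudosnake density of a finite graph is the maximum number of vertices of a pseudosnake divided by the total number of vertices. Let $\tau_n$ be the pseudosnake density of $\mathcal{G}(L,[0;n-1]^2)$; the limit $\tau(L)=\lim_{n\to\infty}\tau_n$ exists and is called the pseudosnake density of $L$. $\eta$ denotes the pseudosnake density of the four-dimensional infinite grid graph, i.e. the limit as $n\to\infty$ of the pseudosnake density of the grid graph on $[0;n-1]^4$ (points adjacent iff at Euclidean distance $1$). -}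

module Defs where

open import Data.Nat using (ℕ; zero; suc; _+_; _*_; _^_; _≤_; _<_; ∣_-_∣)
open import Data.Nat.GCD using (gcd)
open import Data.Nat.DivMod using (_%_)
open import Data.Product using (_×_; _,_; Σ)
open import Data.Sum using (_⊎_)
open import Data.Vec using (Vec; lookup; foldr; zipWith)
open import Data.Fin using (Fin)
open import Data.List using (List; length)
open import Data.List.Relation.Unary.All using (All)
open import Data.List.Relation.Unary.Unique.Propositional using (Unique)
open import Data.List.Membership.Propositional using (_∈_)
open import Data.Empty using (⊥)
open import Relation.Binary.PropositionalEquality using (_≡_; _≢_)

-- A pseudosnake is an induced subgraph (given by a duplicate-free list
-- of vertices of S) in which every vertex has degree at most 2, i.e.
-- no vertex of it has three distinct neighbours inside it.

record Pseudosnake {V : Set} (Adj : V → V → Set) (InS : V → Set) : Set where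
  field
    cells    : List V
    distinct : Unique cells
    inS      : All InS cells
    deg≤2    : ∀ {v a b c} → v ∈ cells → a ∈ cells → b ∈ cells → c ∈ cells →
               Adj v a → Adj v b → Adj v c → a ≢ b → a ≢ c → b ≢ c → ⊥

IsMaxPseudosnakeSize : {V : Set} (Adj : V → V → Set) (InS : V → Set) → ℕ → Set
IsMaxPseudosnakeSize Adj InS k =
  Σ (Pseudosnake Adj InS) (λ P → length (Pseudosnake.cells P) ≡ k)
  × ((P : Pseudosnake Adj InS) → length (Pseudosnake.cells P) ≤ k)

Cell : Set
Cell = ℕ × ℕ

LeaperAdj : ℕ → ℕ → Cell → Cell → Set
LeaperAdj p q (x₁ , y₁) (x₂ , y₂) =
  (∣ x₁ - x₂ ∣ ≡ p × ∣ y₁ - y₂ ∣ ≡ q) ⊎ (∣ x₁ - x₂ ∣ ≡ q × ∣ y₁ - y₂ ∣ ≡ p)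

InBoard : ℕ → Cell → Set
InBoard n (x , y) = x < n × y < n

SkewFree : ℕ → ℕ → Set
SkewFree p q = 0 < p × p < q × gcd p q ≡ 1 × (p + q) % 2 ≡ 1

Point4 : Set
Point4 = Vec ℕ 4

sqDist : Point4 → Point4 → ℕ
sqDist a b = foldr _ _+_ 0 (zipWith (λ u v → ∣ u - v ∣ ^ 2) a b)

GridAdj : Point4 → Point4 → Set
GridAdj a b = sqDist a b ≡ 1

InCube : ℕ → Point4 → Set
InCube m a = (i : Fin 4) → lookup a i < m

{-# OPTIONS --safe #-}
-- Since p + q is odd, every leaper move changes the parity of x + y, so both parity classes of
-- the board are independent sets, hence pseudosnakes, and one of them has at least n²/2 cells.
--
-- For the upper bound, fold ℕ⁴ onto the torus (ℤ/P)², P = n + q, by the linear map sending the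
-- unit vectors to the leaper moves (p, q), (q, p), (p, −q), (q, −p), followed by a translation u.
-- When two grid neighbours both land on the n × n board, the margin q rules out wrap-around, so
-- they land on leaper neighbours, and distinct grid directions give distinct moves. Hence the
-- preimage in [0, m−1]⁴ of a leaper pseudosnake S is a grid pseudosnake. From every grid point
-- each cell of S is hit by some translation, so averaging over the P² translations gives
-- m⁴ |S| ≤ P² g, that is τₙ ≤ (1 + q/n)² η_m.
module Submission where

open import Defs
open import Data.Nat using (ℕ; _+_; _*_; _^_; _≤_; _≥_)
open import Data.Product using (Σ; _×_)

open import Data.Nat using (zero; suc; _<_; _∸_; ∣_-_∣; z≤n; s≤s; NonZero; >-nonZero; parity)
open import Data.Nat.Properties
open import Data.Nat.DivMod using (_%_; %-distribˡ-+; m%n%n≡m%n; [m+n]%n≡m%n; m<n⇒m%n≡m; m%n<n; m%n≤n)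
open import Data.Nat.ListAction using (sum)
open import Data.Nat.Tactic.RingSolver using (solve-∀)
open import Algebra.Properties.CommutativeSemigroup +-commutativeSemigroup
  using (interchange; x∙yz≈y∙xz; xy∙z≈xz∙y)
open import Data.Parity.Base as ℙ using (Parity; 0ℙ; 1ℙ)
open import Data.Parity.Properties using (+-homo-+; p+p≡0ℙ; p≢p⁻¹) renaming (_≟_ to _≟ℙ_)
open import Data.Sign as Sign using (Sign)
import Data.Sign.Properties as Sign
open import Data.Fin using (Fin; zero; suc)
open import Data.Fin.Patterns using (0F; 1F; 2F; 3F)
import Data.Vec as Vec
open Vec using (Vec; []; _∷_; foldr; zipWith; lookup; tabulate; _[_]%=_)
open import Data.Vec.Properties using (∷-injective; ∷-injectiveˡ; ∷-injectiveʳ; lookup∘tabulate)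
open import Data.Product using (_,_; proj₁; proj₂; ∃; ∃₂; uncurry)
open import Data.Product.Properties using (≡-dec)
open import Data.Sum as Sum using (_⊎_; inj₁; inj₂)
open import Data.List using (List; []; _∷_; _++_; length; map; filter; upTo; cartesianProduct)
open import Data.List.Properties using (length-++; length-map; length-upTo; map-cong)
open import Data.List.Relation.Unary.All as All using (All)
open import Data.List.Relation.Unary.AllPairs using ([]; _∷_)
open import Data.List.Relation.Unary.Any using (here; there)
open import Data.List.Relation.Unary.Unique.Propositional using (Unique)
open import Data.List.Relation.Unary.Unique.Propositional.Properties
  using (filter⁺; map⁺; cartesianProduct⁺; upTo⁺)
open import Data.List.Membership.Propositional using (_∈_)
open import Data.List.Membership.Propositional.Properties
  using (∈-∃++; ∈-++⁻; ∈-++⁺ˡ; ∈-++⁺ʳ; ∈-map⁺; ∈-map⁻; ∈-filter⁺; ∈-filter⁻;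
         ∈-cartesianProduct⁺; ∈-cartesianProduct⁻; ∈-upTo⁺; ∈-upTo⁻)
open import Function using (_∘_)
open import Relation.Nullary using (¬_; Dec; yes; no; contradiction)
open import Relation.Unary using (Decidable)
open import Relation.Binary using (DecidableEquality)
open import Relation.Binary.PropositionalEquality
  using (_≡_; _≢_; refl; sym; trans; cong; cong₂; subst; module ≡-Reasoning)

-- Counting

module _ {A : Set} where

  ∈-++-skip : ∀ (as : List A) {bs x y} → y ∈ as ++ x ∷ bs → y ≢ x → y ∈ as ++ bs
  ∈-++-skip as y∈ y≢x with ∈-++⁻ as y∈
  ... | inj₁ y∈as         = ∈-++⁺ˡ y∈as
  ... | inj₂ (here y≡x)   = contradiction y≡x y≢x
  ... | inj₂ (there y∈bs) = ∈-++⁺ʳ as y∈bs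

  Unique∧⊆⇒length≤ : ∀ {xs ys : List A} → Unique xs → (∀ {z} → z ∈ xs → z ∈ ys) →
                     length xs ≤ length ys
  Unique∧⊆⇒length≤ {[]}     _           _     = z≤n
  Unique∧⊆⇒length≤ {x ∷ xs} (x∉xs ∷ xs!) xs⊆ys
    with as , bs , refl ← ∈-∃++ (xs⊆ys (here refl)) = begin
      suc (length xs)               ≤⟨ s≤s (Unique∧⊆⇒length≤ xs! xs⊆as++bs) ⟩
      suc (length (as ++ bs))       ≡⟨ cong suc (length-++ as) ⟩
      suc (length as + length bs)   ≡⟨ +-suc (length as) (length bs) ⟨
      length as + length (x ∷ bs)   ≡⟨ length-++ as ⟨
      length (as ++ x ∷ bs)         ∎
    where
    open ≤-Reasoning
    xs⊆as++bs : ∀ {z} → z ∈ xs → z ∈ as ++ bs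
    xs⊆as++bs z∈xs = ∈-++-skip as (xs⊆ys (there z∈xs)) (λ z≡x → All.lookup x∉xs z∈xs (sym z≡x))

length-cartesianProduct : ∀ {A B : Set} (xs : List A) (ys : List B) →
                          length (cartesianProduct xs ys) ≡ length xs * length ys
length-cartesianProduct []       ys = refl
length-cartesianProduct (x ∷ xs) ys = begin
  length (map (x ,_) ys ++ cartesianProduct xs ys)          ≡⟨ length-++ (map (x ,_) ys) ⟩
  length (map (x ,_) ys) + length (cartesianProduct xs ys)  ≡⟨ cong₂ _+_ (length-map (x ,_) ys)
                                                                        (length-cartesianProduct xs ys) ⟩
  length ys + length xs * length ys                         ∎
  where open ≡-Reasoning

indicator : {P : Set} → Dec P → ℕ
indicator (yes _) = 1
indicator (no  _) = 0

module _ {A : Set} where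

  sum-map-0 : ∀ (xs : List A) → sum (map (λ _ → 0) xs) ≡ 0
  sum-map-0 []       = refl
  sum-map-0 (_ ∷ xs) = sum-map-0 xs

  sum-map-+ : ∀ (f g : A → ℕ) xs → sum (map (λ x → f x + g x) xs) ≡ sum (map f xs) + sum (map g xs)
  sum-map-+ f g []       = refl
  sum-map-+ f g (x ∷ xs) = trans (cong (f x + g x +_) (sum-map-+ f g xs))
                                 (interchange (f x) (g x) (sum (map f xs)) (sum (map g xs)))

  length-filter≡sum-indicator : ∀ {P : A → Set} (P? : Decidable P) xs →
                                length (filter P? xs) ≡ sum (map (λ x → indicator (P? x)) xs)
  length-filter≡sum-indicator P? []       = refl
  length-filter≡sum-indicator P? (x ∷ xs) with P? x
  ... | yes _ = cong suc (length-filter≡sum-indicator P? xs)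
  ... | no  _ = length-filter≡sum-indicator P? xs

module _ {A B : Set} where

  sum-map-comm : ∀ (f : A → B → ℕ) as bs →
                 sum (map (λ a → sum (map (f a) bs)) as) ≡ sum (map (λ b → sum (map (λ a → f a b) as)) bs)
  sum-map-comm f []       bs = sym (sum-map-0 bs)
  sum-map-comm f (a ∷ as) bs = begin
    sum (map (f a) bs) + sum (map (λ a′ → sum (map (f a′) bs)) as)
      ≡⟨ cong (sum (map (f a) bs) +_) (sum-map-comm f as bs) ⟩
    sum (map (f a) bs) + sum (map (λ b → sum (map (λ a′ → f a′ b) as)) bs)
      ≡⟨ sum-map-+ (f a) _ bs ⟨
    sum (map (λ b → f a b + sum (map (λ a′ → f a′ b) as)) bs)
      ∎
    where open ≡-Reasoning

  count-comm : ∀ {R : A → B → Set} (R? : ∀ a b → Dec (R a b)) as bs →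
               sum (map (λ a → length (filter (R? a) bs)) as) ≡
               sum (map (λ b → length (filter (λ a → R? a b) as)) bs)
  count-comm R? as bs = begin
    sum (map (λ a → length (filter (R? a) bs)) as)
      ≡⟨ cong sum (map-cong (λ a → length-filter≡sum-indicator (R? a) bs) as) ⟩
    sum (map (λ a → sum (map (λ b → indicator (R? a b)) bs)) as)
      ≡⟨ sum-map-comm (λ a b → indicator (R? a b)) as bs ⟩
    sum (map (λ b → sum (map (λ a → indicator (R? a b)) as)) bs)
      ≡⟨ cong sum (map-cong (λ b → length-filter≡sum-indicator (λ a → R? a b) as) bs) ⟨
    sum (map (λ b → length (filter (λ a → R? a b) as)) bs)
      ∎
    where open ≡-Reasoning

module _ {A : Set} (f : A → ℕ) {c : ℕ} where

  sum-map-≤ : ∀ xs → (∀ x → f x ≤ c) → sum (map f xs) ≤ length xs * c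
  sum-map-≤ []       _   = z≤n
  sum-map-≤ (x ∷ xs) f≤c = +-mono-≤ (f≤c x) (sum-map-≤ xs f≤c)

  sum-map-≥ : ∀ xs → (∀ x → c ≤ f x) → length xs * c ≤ sum (map f xs)
  sum-map-≥ []       _   = z≤n
  sum-map-≥ (x ∷ xs) c≤f = +-mono-≤ (c≤f x) (sum-map-≥ xs c≤f)

module _ {U X W : Set} (_≟_ : DecidableEquality W) where
  open import Data.List.Membership.DecPropositional _≟_ using (_∈?_)

  averaging : ∀ (f : U → X → W) us xs {S} → Unique S →
              (∀ x {c} → c ∈ S → ∃ λ u → u ∈ us × f u x ≡ c) →
              length xs * length S ≤ sum (map (λ u → length (filter (λ x → f u x ∈? S) xs)) us)
  averaging f us xs {S} S! onto = begin
    length xs * length S                                             ≤⟨ sum-map-≥ _ xs hits ⟩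
    sum (map (λ x → length (filter (λ u → f u x ∈? S) us)) xs)      ≡⟨ count-comm (λ u x → f u x ∈? S) us xs ⟨
    sum (map (λ u → length (filter (λ x → f u x ∈? S) xs)) us)      ∎
    where
    open ≤-Reasoning
    hits : ∀ x → length S ≤ length (filter (λ u → f u x ∈? S) us)
    hits x = subst (length S ≤_) (length-map (λ u → f u x) (filter (λ u → f u x ∈? S) us))
                   (Unique∧⊆⇒length≤ S! S⊆image)
      where
      S⊆image : ∀ {c} → c ∈ S → c ∈ map (λ u → f u x) (filter (λ u → f u x ∈? S) us)
      S⊆image c∈S with u , u∈us , refl ← onto x c∈S = ∈-map⁺ (λ u → f u x) (∈-filter⁺ (λ u → f u x ∈? S) u∈us c∈S)

-- Pseudosnakes

module _ {V : Set} {Adj : V → V → Set} {InS : V → Set} where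

  independent⇒pseudosnake : ∀ xs → Unique xs → All InS xs →
                            (∀ {a b} → a ∈ xs → b ∈ xs → ¬ Adj a b) → Pseudosnake Adj InS
  independent⇒pseudosnake xs xs! xs∈S indep = record
    { cells = xs ; distinct = xs! ; inS = xs∈S
    ; deg≤2 = λ v∈ a∈ _ _ va _ _ _ _ _ → indep v∈ a∈ va
    }

  length-pseudosnake≤ : ∀ (P : Pseudosnake Adj InS) {ys} → (∀ {v} → InS v → v ∈ ys) →
                        length (Pseudosnake.cells P) ≤ length ys
  length-pseudosnake≤ P S⊆ys = Unique∧⊆⇒length≤ distinct (λ v∈ → S⊆ys (All.lookup inS v∈))
    where open Pseudosnake P

module _ {V W : Set} (_≟_ : DecidableEquality W)
         {Adj : V → V → Set} {InS : V → Set} {Adj′ : W → W → Set} {InS′ : W → Set}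
         (f : V → W) (S : Pseudosnake Adj′ InS′) where
  open import Data.List.Membership.DecPropositional _≟_ using (_∈?_)
  open Pseudosnake S

  pullback : ∀ xs → Unique xs → All InS xs →
             (∀ {v a} → InS′ (f v) → InS′ (f a) → Adj v a → Adj′ (f v) (f a)) →
             (∀ {v a b} → InS′ (f v) → InS′ (f a) → InS′ (f b) → Adj v a → Adj v b → f a ≡ f b → a ≡ b) →
             Pseudosnake Adj InS
  pullback xs xs! xs∈S hom locally-injective = record
    { cells    = filter (λ x → f x ∈? cells) xs
    ; distinct = filter⁺ (λ x → f x ∈? cells) xs!
    ; inS      = All.tabulate (λ x∈ → All.lookup xs∈S (proj₁ (∈-filter⁻ (λ x → f x ∈? cells) {xs = xs} x∈)))
    ; deg≤2    = λ v∈ a∈ b∈ c∈ va vb vc a≢b a≢c b≢c →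
        deg≤2 (∈S v∈) (∈S a∈) (∈S b∈) (∈S c∈) (hom′ v∈ a∈ va) (hom′ v∈ b∈ vb) (hom′ v∈ c∈ vc)
              (a≢b ∘ injective′ v∈ a∈ b∈ va vb) (a≢c ∘ injective′ v∈ a∈ c∈ va vc) (b≢c ∘ injective′ v∈ b∈ c∈ vb vc)
    }
    where
    preimage : List V
    preimage = filter (λ x → f x ∈? cells) xs
    ∈S : ∀ {x} → x ∈ preimage → f x ∈ cells
    ∈S x∈ = proj₂ (∈-filter⁻ (λ x → f x ∈? cells) {xs = xs} x∈)
    inS′ : ∀ {x} → x ∈ preimage → InS′ (f x)
    inS′ = All.lookup inS ∘ ∈S
    hom′ : ∀ {v a} → v ∈ preimage → a ∈ preimage → Adj v a → Adj′ (f v) (f a)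
    hom′ v∈ a∈ = hom (inS′ v∈) (inS′ a∈)
    injective′ : ∀ {v a b} → v ∈ preimage → a ∈ preimage → b ∈ preimage →
                 Adj v a → Adj v b → f a ≡ f b → a ≡ b
    injective′ v∈ a∈ b∈ = locally-injective (inS′ v∈) (inS′ a∈) (inS′ b∈)

-- The board and its parity colouring

board : ℕ → List Cell
board n = cartesianProduct (upTo n) (upTo n)

board-unique : ∀ n → Unique (board n)
board-unique n = cartesianProduct⁺ (upTo⁺ n) (upTo⁺ n)

∈-board⁺ : ∀ {n c} → InBoard n c → c ∈ board n
∈-board⁺ (x<n , y<n) = ∈-cartesianProduct⁺ (∈-upTo⁺ x<n) (∈-upTo⁺ y<n)

∈-board⁻ : ∀ {n c} → c ∈ board n → InBoard n c
∈-board⁻ {n} c∈ with x∈ , y∈ ← ∈-cartesianProduct⁻ (upTo n) (upTo n) c∈ = ∈-upTo⁻ x∈ , ∈-upTo⁻ y∈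

length-board : ∀ n → length (board n) ≡ n * n
length-board n = trans (length-cartesianProduct (upTo n) (upTo n)) (cong₂ _*_ (length-upTo n) (length-upTo n))

parity-∣-∣ : ∀ m n → parity ∣ m - n ∣ ≡ parity (m + n)
parity-∣-∣ zero    n       = refl
parity-∣-∣ (suc m) zero    = cong parity (sym (+-identityʳ (suc m)))
parity-∣-∣ (suc m) (suc n) = trans (parity-∣-∣ m n) (cong (parity ∘ suc) (sym (+-suc m n)))

parity-odd : ∀ n → n % 2 ≡ 1 → parity n ≡ 1ℙ
parity-odd 1             _   = refl
parity-odd (suc (suc n)) odd = parity-odd n odd

module _ {A : Set} (f : A → Parity) where

  length-filter-0ℙ+1ℙ : ∀ xs → length (filter (λ x → f x ≟ℙ 0ℙ) xs) + length (filter (λ x → f x ≟ℙ 1ℙ) xs)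
                               ≡ length xs
  length-filter-0ℙ+1ℙ []       = refl
  length-filter-0ℙ+1ℙ (x ∷ xs) with f x
  ... | 0ℙ = cong suc (length-filter-0ℙ+1ℙ xs)
  ... | 1ℙ = trans (+-suc _ _) (cong suc (length-filter-0ℙ+1ℙ xs))

colour : Cell → Parity
colour (x , y) = parity (x + y)

module Colouring {p q : ℕ} (p+q-odd : (p + q) % 2 ≡ 1) where

  leaperAdj⇒colour+colour≡1ℙ : ∀ {a b} → LeaperAdj p q a b → colour a ℙ.+ colour b ≡ 1ℙ
  leaperAdj⇒colour+colour≡1ℙ {x₁ , y₁} {x₂ , y₂} adj = begin
    parity (x₁ + y₁) ℙ.+ parity (x₂ + y₂)         ≡⟨ +-homo-+ (x₁ + y₁) (x₂ + y₂) ⟨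
    parity ((x₁ + y₁) + (x₂ + y₂))                 ≡⟨ cong parity (interchange x₁ y₁ x₂ y₂) ⟩
    parity ((x₁ + x₂) + (y₁ + y₂))                 ≡⟨ +-homo-+ (x₁ + x₂) (y₁ + y₂) ⟩
    parity (x₁ + x₂) ℙ.+ parity (y₁ + y₂)          ≡⟨ cong₂ ℙ._+_ (parity-∣-∣ x₁ x₂) (parity-∣-∣ y₁ y₂) ⟨
    parity ∣ x₁ - x₂ ∣ ℙ.+ parity ∣ y₁ - y₂ ∣      ≡⟨ +-homo-+ ∣ x₁ - x₂ ∣ ∣ y₁ - y₂ ∣ ⟨
    parity (∣ x₁ - x₂ ∣ + ∣ y₁ - y₂ ∣)             ≡⟨ cong parity (leg-sum adj) ⟩
    parity (p + q)                                 ≡⟨ parity-odd (p + q) p+q-odd ⟩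
    1ℙ                                             ∎
    where
    open ≡-Reasoning
    leg-sum : LeaperAdj p q (x₁ , y₁) (x₂ , y₂) → ∣ x₁ - x₂ ∣ + ∣ y₁ - y₂ ∣ ≡ p + q
    leg-sum (inj₁ (refl , refl)) = refl
    leg-sum (inj₂ (refl , refl)) = +-comm q p

  colourClass : ∀ n → Parity → Pseudosnake (LeaperAdj p q) (InBoard n)
  colourClass n π = independent⇒pseudosnake (filter is-π? (board n)) (filter⁺ is-π? (board-unique n))
    (All.tabulate (λ c∈ → ∈-board⁻ (proj₁ (∈-class⁻ c∈))))
    (λ {a} {b} a∈ b∈ → monochromatic {a} {b} (proj₂ (∈-class⁻ a∈)) (proj₂ (∈-class⁻ b∈)))
    where
    is-π? : Decidable (λ c → colour c ≡ π)
    is-π? c = colour c ≟ℙ π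
    ∈-class⁻ : ∀ {c} → c ∈ filter is-π? (board n) → c ∈ board n × colour c ≡ π
    ∈-class⁻ = ∈-filter⁻ is-π? {xs = board n}
    monochromatic : ∀ {a b} → colour a ≡ π → colour b ≡ π → ¬ LeaperAdj p q a b
    monochromatic {a} {b} a≡π b≡π ab = p≢p⁻¹ 0ℙ (begin
        0ℙ                     ≡⟨ p+p≡0ℙ π ⟨
        π ℙ.+ π                ≡⟨ cong₂ ℙ._+_ a≡π b≡π ⟨
        colour a ℙ.+ colour b  ≡⟨ leaperAdj⇒colour+colour≡1ℙ {a} {b} ab ⟩
        1ℙ                     ∎)
      where open ≡-Reasoning

  board≤2*pseudosnake : ∀ n s → IsMaxPseudosnakeSize (LeaperAdj p q) (InBoard n) s → n * n ≤ 2 * s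
  board≤2*pseudosnake n s (_ , maximal) = begin
    n * n                                            ≡⟨ length-board n ⟨
    length (board n)                                 ≡⟨ length-filter-0ℙ+1ℙ colour (board n) ⟨
    length (cells (colourClass n 0ℙ)) + length (cells (colourClass n 1ℙ))
                                                     ≤⟨ +-mono-≤ (maximal (colourClass n 0ℙ)) (maximal (colourClass n 1ℙ)) ⟩
    s + s                                            ≡⟨ cong (s +_) (+-identityʳ s) ⟨
    2 * s                                            ∎
    where
    open ≤-Reasoning
    open Pseudosnake using (cells)

-- The grid

-- sqDist of Defs, for vectors of any length.
squaredDistance : ∀ {k} → Vec ℕ k → Vec ℕ k → ℕ
squaredDistance a b = foldr _ _+_ 0 (zipWith (λ u v → ∣ u - v ∣ ^ 2) a b)

GridStep : ∀ {k} → Sign → Fin k → Vec ℕ k → Vec ℕ k → Set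
GridStep Sign.+ i x a = a ≡ x [ i ]%= suc
GridStep Sign.- i x a = x ≡ a [ i ]%= suc

m^2+n≡1⇒ : ∀ m n → m ^ 2 + n ≡ 1 → (m ≡ 0 × n ≡ 1) ⊎ (m ≡ 1 × n ≡ 0)
m^2+n≡1⇒ 0             n eq = inj₁ (refl , eq)
m^2+n≡1⇒ 1             n eq = inj₂ (refl , suc-injective eq)
m^2+n≡1⇒ (suc (suc m)) n ()

∣m-n∣≡1⇒ : ∀ m n → ∣ m - n ∣ ≡ 1 → n ≡ suc m ⊎ m ≡ suc n
∣m-n∣≡1⇒ zero    (suc n) eq = inj₁ (cong suc (suc-injective eq))
∣m-n∣≡1⇒ (suc m) zero    eq = inj₂ (cong suc (suc-injective eq))
∣m-n∣≡1⇒ (suc m) (suc n) eq = Sum.map (cong suc) (cong suc) (∣m-n∣≡1⇒ m n eq)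

squaredDistance≡0⇒≡ : ∀ {k} (x a : Vec ℕ k) → squaredDistance x a ≡ 0 → x ≡ a
squaredDistance≡0⇒≡ []       []       _  = refl
squaredDistance≡0⇒≡ (x ∷ xs) (a ∷ as) eq = cong₂ _∷_
  (∣m-n∣≡0⇒m≡n (m^n≡0⇒m≡0 _ 2 (m+n≡0⇒m≡0 _ eq)))
  (squaredDistance≡0⇒≡ xs as (m+n≡0⇒n≡0 (∣ x - a ∣ ^ 2) eq))

squaredDistance≡1⇒GridStep : ∀ {k} (x a : Vec ℕ k) → squaredDistance x a ≡ 1 → ∃₂ λ s i → GridStep s i x a
squaredDistance≡1⇒GridStep []       []       ()
squaredDistance≡1⇒GridStep (x ∷ xs) (a ∷ as) eq with m^2+n≡1⇒ ∣ x - a ∣ _ eq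
... | inj₁ (d≡0 , rest≡1) with refl ← ∣m-n∣≡0⇒m≡n {x} {a} d≡0 | squaredDistance≡1⇒GridStep xs as rest≡1
...   | Sign.+ , i , refl = Sign.+ , suc i , refl
...   | Sign.- , i , refl = Sign.- , suc i , refl
squaredDistance≡1⇒GridStep (x ∷ xs) (a ∷ as) eq
    | inj₂ (d≡1 , rest≡0) with refl ← squaredDistance≡0⇒≡ xs as rest≡0 | ∣m-n∣≡1⇒ x a d≡1
...   | inj₁ refl = Sign.+ , zero , refl
...   | inj₂ refl = Sign.- , zero , refl

[]%=suc-injective : ∀ {k} i (a b : Vec ℕ k) → a [ i ]%= suc ≡ b [ i ]%= suc → a ≡ b
[]%=suc-injective zero    (a ∷ as) (b ∷ bs) refl = refl
[]%=suc-injective (suc i) (a ∷ as) (b ∷ bs) eq   =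
  cong₂ _∷_ (∷-injectiveˡ eq) ([]%=suc-injective i as bs (∷-injectiveʳ eq))

GridStep-functional : ∀ {k} s i {x a b : Vec ℕ k} → GridStep s i x a → GridStep s i x b → a ≡ b
GridStep-functional Sign.+ i a≡ b≡ = trans a≡ (sym b≡)
GridStep-functional Sign.- i {a = a} {b} x≡ x≡′ = []%=suc-injective i a b (trans (sym x≡) x≡′)

_·_ : ∀ {k} → Vec ℕ k → Vec ℕ k → ℕ
[]       · []       = 0
(w ∷ ws) · (x ∷ xs) = w * x + ws · xs

·-[]%=suc : ∀ {k} (w x : Vec ℕ k) i → w · (x [ i ]%= suc) ≡ w · x + lookup w i
·-[]%=suc (w ∷ ws) (x ∷ xs) zero    = begin
  w * suc x + ws · xs     ≡⟨ cong (_+ ws · xs) (*-suc w x) ⟩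
  w + w * x + ws · xs     ≡⟨ +-assoc w (w * x) (ws · xs) ⟩
  w + (w * x + ws · xs)   ≡⟨ +-comm w _ ⟩
  w * x + ws · xs + w     ∎
  where open ≡-Reasoning
·-[]%=suc (w ∷ ws) (x ∷ xs) (suc i) =
  trans (cong (w * x +_) (·-[]%=suc ws xs i)) (sym (+-assoc (w * x) (ws · xs) (lookup ws i)))

cube : ∀ k → ℕ → List (Vec ℕ k)
cube zero    m = [] ∷ []
cube (suc k) m = map (uncurry Vec._∷_) (cartesianProduct (upTo m) (cube k m))

cube-unique : ∀ k m → Unique (cube k m)
cube-unique zero    m = All.[] ∷ []
cube-unique (suc k) m = map⁺ (λ eq → uncurry (cong₂ _,_) (∷-injective eq))
                             (cartesianProduct⁺ (upTo⁺ m) (cube-unique k m))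

∈-cube⁺ : ∀ {k m} {x : Vec ℕ k} → (∀ i → lookup x i < m) → x ∈ cube k m
∈-cube⁺ {x = []}     _     = here refl
∈-cube⁺ {x = a ∷ as} x<m = ∈-map⁺ (uncurry Vec._∷_) (∈-cartesianProduct⁺ (∈-upTo⁺ (x<m zero)) (∈-cube⁺ (x<m ∘ suc)))

∈-cube⁻ : ∀ {k m} {x : Vec ℕ k} → x ∈ cube k m → ∀ i → lookup x i < m
∈-cube⁻ {suc k} {m} x∈ zero    with (a , as) , a,as∈ , refl ← ∈-map⁻ (uncurry Vec._∷_) x∈ =
  ∈-upTo⁻ (proj₁ (∈-cartesianProduct⁻ (upTo m) (cube k m) a,as∈))
∈-cube⁻ {suc k} {m} x∈ (suc i) with (a , as) , a,as∈ , refl ← ∈-map⁻ (uncurry Vec._∷_) x∈ =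
  ∈-cube⁻ (proj₂ (∈-cartesianProduct⁻ (upTo m) (cube k m) a,as∈)) i

length-cube : ∀ k m → length (cube k m) ≡ m ^ k
length-cube zero    m = refl
length-cube (suc k) m = begin
  length (map (uncurry Vec._∷_) (cartesianProduct (upTo m) (cube k m)))
    ≡⟨ length-map (uncurry Vec._∷_) (cartesianProduct (upTo m) (cube k m)) ⟩
  length (cartesianProduct (upTo m) (cube k m))
    ≡⟨ length-cartesianProduct (upTo m) (cube k m) ⟩
  length (upTo m) * length (cube k m)
    ≡⟨ cong₂ _*_ (length-upTo m) (length-cube k m) ⟩
  m * m ^ k
    ∎
  where open ≡-Reasoning

-- Folding the grid onto a torus

Shift : Sign → ℕ → ℕ → ℕ → Set
Shift Sign.+ k y c = c ≡ y + k
Shift Sign.- k y c = y ≡ c + k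

Shift⇒∣-∣≡ : ∀ s {k y c} → Shift s k y c → ∣ y - c ∣ ≡ k
Shift⇒∣-∣≡ Sign.+ {k} {y}     refl = ∣m-m+n∣≡n y k
Shift⇒∣-∣≡ Sign.- {k} {c = c} refl = trans (∣-∣-comm (c + k) c) (∣m-m+n∣≡n c k)

Shift-opposite : ∀ s {k y c} → Shift s k y c → Shift (Sign.opposite s) k c y
Shift-opposite Sign.+ h = h
Shift-opposite Sign.- h = h

m≢m+n+o : ∀ m {n o} → 0 < n → m ≢ m + n + o
m≢m+n+o m {n} {o} 0<n = <⇒≢ (<-≤-trans (m<m+n m 0<n) (m≤m+n (m + n) o))

Shift-unique : ∀ s s′ {k k′ y c} → 0 < k → Shift s k y c → Shift s′ k′ y c → s ≡ s′ × k ≡ k′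
Shift-unique Sign.+ Sign.+ {y = y} _   refl c≡ = refl , +-cancelˡ-≡ y _ _ c≡
Shift-unique Sign.- Sign.- {c = c} _   refl y≡ = refl , +-cancelˡ-≡ c _ _ y≡
Shift-unique Sign.+ Sign.- {y = y} 0<k refl y≡ = contradiction y≡ (m≢m+n+o y 0<k)
Shift-unique Sign.- Sign.+ {c = c} 0<k refl c≡ = contradiction c≡ (m≢m+n+o c 0<k)

module Torus (P : ℕ) .{{_ : NonZero P}} where

  residue : Sign → ℕ → ℕ
  residue Sign.+ k = k
  residue Sign.- k = P ∸ k

  [m%P+n]%P≡[m+n]%P : ∀ m n → (m % P + n) % P ≡ (m + n) % P
  [m%P+n]%P≡[m+n]%P m n = begin
    (m % P + n) % P          ≡⟨ %-distribˡ-+ (m % P) n P ⟩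
    (m % P % P + n % P) % P  ≡⟨ cong (λ t → (t + n % P) % P) (m%n%n≡m%n m P) ⟩
    (m % P + n % P) % P      ≡⟨ %-distribˡ-+ m n P ⟨
    (m + n) % P              ∎
    where open ≡-Reasoning

  [m+n%P]%P≡[m+n]%P : ∀ m n → (m + n % P) % P ≡ (m + n) % P
  [m+n%P]%P≡[m+n]%P m n = begin
    (m + n % P) % P  ≡⟨ cong (_% P) (+-comm m (n % P)) ⟩
    (n % P + m) % P  ≡⟨ [m%P+n]%P≡[m+n]%P n m ⟩
    (n + m) % P      ≡⟨ cong (_% P) (+-comm n m) ⟩
    (m + n) % P      ∎
    where open ≡-Reasoning

  translation-onto : ∀ z {c} → c < P → ∃ λ u → u < P × (z + u) % P ≡ c
  translation-onto z {c} c<P = (c + (P ∸ z % P)) % P , m%n<n _ P , (begin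
    (z + (c + (P ∸ z % P)) % P) % P  ≡⟨ [m+n%P]%P≡[m+n]%P z _ ⟩
    (z + (c + (P ∸ z % P))) % P      ≡⟨ [m%P+n]%P≡[m+n]%P z _ ⟨
    (z % P + (c + (P ∸ z % P))) % P  ≡⟨ cong (_% P) (x∙yz≈y∙xz (z % P) c _) ⟩
    (c + (z % P + (P ∸ z % P))) % P  ≡⟨ cong (λ t → (c + t) % P) (m+[n∸m]≡n (m%n≤n z P)) ⟩
    (c + P) % P                      ≡⟨ [m+n]%n≡m%n c P ⟩
    c % P                            ≡⟨ m<n⇒m%n≡m c<P ⟩
    c                                ∎)
    where open ≡-Reasoning

  module _ {n l : ℕ} (n+l≤P : n + l ≤ P) where

    -- The margin n + l ≤ P leaves no room for wrap-around.
    Shift-% : ∀ s {y} → y < n → (y + residue s l) % P < n → Shift s l y ((y + residue s l) % P)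
    Shift-% Sign.+     y<n _   = m<n⇒m%n≡m (<-≤-trans (+-monoˡ-< l y<n) n+l≤P)
    Shift-% Sign.- {y} y<n c<n with l ≤? y
    ... | yes l≤y = sym (trans (cong (_+ l) wrapped) (m∸n+n≡m l≤y))
      where
      open ≡-Reasoning
      wrapped : (y + (P ∸ l)) % P ≡ y ∸ l
      wrapped = begin
        (y + (P ∸ l)) % P        ≡⟨ cong (λ t → (t + (P ∸ l)) % P) (m∸n+n≡m l≤y) ⟨
        (y ∸ l + l + (P ∸ l)) % P ≡⟨ cong (_% P) (+-assoc (y ∸ l) l (P ∸ l)) ⟩
        (y ∸ l + (l + (P ∸ l))) % P ≡⟨ cong (λ t → (y ∸ l + t) % P) (m+[n∸m]≡n (≤-trans (m≤n+m l n) n+l≤P)) ⟩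
        (y ∸ l + P) % P          ≡⟨ [m+n]%n≡m%n (y ∸ l) P ⟩
        (y ∸ l) % P              ≡⟨ m<n⇒m%n≡m (≤-<-trans (m∸n≤m y l) (<-≤-trans y<n (≤-trans (m≤m+n n l) n+l≤P))) ⟩
        y ∸ l                    ∎
    ... | no  l≰y = contradiction c<n (≤⇒≯ (begin
        n                        ≤⟨ m+n≤o⇒m≤o∸n n n+l≤P ⟩
        P ∸ l                    ≤⟨ m≤n+m (P ∸ l) y ⟩
        y + (P ∸ l)              ≡⟨ m<n⇒m%n≡m unwrapped ⟨
        (y + (P ∸ l)) % P        ∎))
      where
      open ≤-Reasoning
      unwrapped : y + (P ∸ l) < P
      unwrapped = subst (y + (P ∸ l) <_) (m+[n∸m]≡n (≤-trans (m≤n+m l n) n+l≤P)) (+-monoˡ-< (P ∸ l) (≰⇒> l≰y))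

    Shift-step : ∀ s {k} (w : Vec ℕ k) u x i → lookup w i ≡ residue s l →
                 (w · x + u) % P < n → (w · (x [ i ]%= suc) + u) % P < n →
                 Shift s l ((w · x + u) % P) ((w · (x [ i ]%= suc) + u) % P)
    Shift-step s w u x i wᵢ≡ y<n c<n =
      subst (Shift s l ((w · x + u) % P)) (sym stepped) (Shift-% s y<n (subst (_< n) stepped c<n))
      where
      open ≡-Reasoning
      stepped : (w · (x [ i ]%= suc) + u) % P ≡ ((w · x + u) % P + residue s l) % P
      stepped = begin
        (w · (x [ i ]%= suc) + u) % P      ≡⟨ cong (λ t → (t + u) % P) (·-[]%=suc w x i) ⟩
        (w · x + lookup w i + u) % P       ≡⟨ cong (_% P) (xy∙z≈xz∙y (w · x) (lookup w i) u) ⟩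
        (w · x + u + lookup w i) % P       ≡⟨ [m%P+n]%P≡[m+n]%P (w · x + u) (lookup w i) ⟨
        ((w · x + u) % P + lookup w i) % P ≡⟨ cong (λ t → ((w · x + u) % P + t) % P) wᵢ≡ ⟩
        ((w · x + u) % P + residue s l) % P ∎

data Leg : Set where
  short long : Leg

other : Leg → Leg
other short = long
other long  = short

module LeaperMoves {p q : ℕ} (0<p : 0 < p) (p<q : p < q) where

  leg : Leg → ℕ
  leg short = p
  leg long  = q

  leg-positive : ∀ l → 0 < leg l
  leg-positive short = 0<p
  leg-positive long  = <-trans 0<p p<q

  leg≤q : ∀ l → leg l ≤ q
  leg≤q short = <⇒≤ p<q
  leg≤q long  = ≤-refl

  leg-injective : ∀ l l′ → leg l ≡ leg l′ → l ≡ l′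
  leg-injective short short _   = refl
  leg-injective long  long  _   = refl
  leg-injective short long  p≡q = contradiction p≡q (<⇒≢ p<q)
  leg-injective long  short q≡p = contradiction (sym q≡p) (<⇒≢ p<q)

  Move : Set
  Move = Sign × Leg × Sign

  LeaperMove : Move → Cell → Cell → Set
  LeaperMove (s₁ , l , s₂) (y₁ , y₂) (c₁ , c₂) = Shift s₁ (leg l) y₁ c₁ × Shift s₂ (leg (other l)) y₂ c₂

  LeaperMove⇒LeaperAdj : ∀ M {y c} → LeaperMove M y c → LeaperAdj p q y c
  LeaperMove⇒LeaperAdj (s₁ , short , s₂) (h₁ , h₂) = inj₁ (Shift⇒∣-∣≡ s₁ h₁ , Shift⇒∣-∣≡ s₂ h₂)
  LeaperMove⇒LeaperAdj (s₁ , long  , s₂) (h₁ , h₂) = inj₂ (Shift⇒∣-∣≡ s₁ h₁ , Shift⇒∣-∣≡ s₂ h₂)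

  LeaperMove-opposite : ∀ s₁ l s₂ {y c} → LeaperMove (s₁ , l , s₂) y c →
                        LeaperMove (Sign.opposite s₁ , l , Sign.opposite s₂) c y
  LeaperMove-opposite s₁ _ s₂ (h₁ , h₂) = Shift-opposite s₁ h₁ , Shift-opposite s₂ h₂

  LeaperMove-unique : ∀ M M′ {y c} → LeaperMove M y c → LeaperMove M′ y c → M ≡ M′
  LeaperMove-unique (s₁ , l , s₂) (s₁′ , l′ , s₂′) (h₁ , h₂) (h₁′ , h₂′)
    with refl , l≡l′ ← Shift-unique s₁ s₁′ (leg-positive l) h₁ h₁′
       | refl , _    ← Shift-unique s₂ s₂′ (leg-positive (other l)) h₂ h₂′
    = cong (λ l → s₁ , l , s₂) (leg-injective l l′ l≡l′)

  axis : Fin 4 → Leg × Sign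
  axis 0F = short , Sign.+
  axis 1F = long  , Sign.+
  axis 2F = short , Sign.-
  axis 3F = long  , Sign.-

  axisIndex : Leg × Sign → Fin 4
  axisIndex (short , Sign.+) = 0F
  axisIndex (long  , Sign.+) = 1F
  axisIndex (short , Sign.-) = 2F
  axisIndex (long  , Sign.-) = 3F

  axisIndex∘axis : ∀ i → axisIndex (axis i) ≡ i
  axisIndex∘axis 0F = refl
  axisIndex∘axis 1F = refl
  axisIndex∘axis 2F = refl
  axisIndex∘axis 3F = refl

  gridMove : Sign → Fin 4 → Move
  gridMove s i = s , proj₁ (axis i) , s Sign.* proj₂ (axis i)

  gridMove-injective : ∀ s i s′ i′ → gridMove s i ≡ gridMove s′ i′ → s ≡ s′ × i ≡ i′
  gridMove-injective s i s′ i′ eq with refl ← cong proj₁ eq = refl , (begin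
    i                      ≡⟨ axisIndex∘axis i ⟨
    axisIndex (axis i)     ≡⟨ cong axisIndex (cong₂ _,_ (cong (proj₁ ∘ proj₂) eq)
                                (Sign.*-cancelˡ-≡ s _ _ (cong (proj₂ ∘ proj₂) eq))) ⟩
    axisIndex (axis i′)    ≡⟨ axisIndex∘axis i′ ⟩
    i′                     ∎)
    where open ≡-Reasoning

_≟Cell_ : DecidableEquality Cell
_≟Cell_ = ≡-dec _≟_ _≟_

module Lifting {p q : ℕ} (0<p : 0 < p) (p<q : p < q) {n P : ℕ} .{{_ : NonZero P}} (n+q≤P : n + q ≤ P) where
  open LeaperMoves 0<p p<q
  open Torus P
  open import Data.List.Membership.DecPropositional _≟Cell_ using (_∈?_)

  -- w₁ = (p, q, p, q) and w₂ = (q, p, −q, −p) modulo P: axis i steps by the leaper move axis i.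
  weight₁ weight₂ : Fin 4 → ℕ
  weight₁ i = leg (proj₁ (axis i))
  weight₂ i = residue (proj₂ (axis i)) (leg (other (proj₁ (axis i))))

  w₁ w₂ : Vec ℕ 4
  w₁ = tabulate weight₁
  w₂ = tabulate weight₂

  fold : Cell → Point4 → Cell
  fold (u₁ , u₂) x = (w₁ · x + u₁) % P , (w₂ · x + u₂) % P

  n+leg≤P : ∀ l → n + leg l ≤ P
  n+leg≤P l = ≤-trans (+-monoʳ-≤ n (leg≤q l)) n+q≤P

  fold-axisStep : ∀ u x i → InBoard n (fold u x) → InBoard n (fold u (x [ i ]%= suc)) →
                  LeaperMove (Sign.+ , axis i) (fold u x) (fold u (x [ i ]%= suc))
  fold-axisStep (u₁ , u₂) x i (y₁<n , y₂<n) (c₁<n , c₂<n) =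
    Shift-step (n+leg≤P l) Sign.+ w₁ u₁ x i (lookup∘tabulate weight₁ i) y₁<n c₁<n ,
    Shift-step (n+leg≤P (other l)) (proj₂ (axis i)) w₂ u₂ x i (lookup∘tabulate weight₂ i) y₂<n c₂<n
    where
    l : Leg
    l = proj₁ (axis i)

  fold-GridStep : ∀ s i u {x a} → GridStep s i x a → InBoard n (fold u x) → InBoard n (fold u a) →
                  LeaperMove (gridMove s i) (fold u x) (fold u a)
  fold-GridStep Sign.+ i u {x}     refl x∈ a∈ = fold-axisStep u x i x∈ a∈
  fold-GridStep Sign.- i u {a = a} refl x∈ a∈ =
    LeaperMove-opposite Sign.+ (proj₁ (axis i)) (proj₂ (axis i)) (fold-axisStep u a i a∈ x∈)

  fold-adj : ∀ u {v a} → InBoard n (fold u v) → InBoard n (fold u a) → GridAdj v a →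
             LeaperAdj p q (fold u v) (fold u a)
  fold-adj u {v} {a} v∈ a∈ va with s , i , step ← squaredDistance≡1⇒GridStep v a va =
    LeaperMove⇒LeaperAdj (gridMove s i) (fold-GridStep s i u step v∈ a∈)

  fold-locally-injective : ∀ u {v a b} → InBoard n (fold u v) → InBoard n (fold u a) → InBoard n (fold u b) →
                           GridAdj v a → GridAdj v b → fold u a ≡ fold u b → a ≡ b
  fold-locally-injective u {v} {a} {b} v∈ a∈ b∈ va vb fa≡fb
    with s , i , va ← squaredDistance≡1⇒GridStep v a va | s′ , i′ , vb ← squaredDistance≡1⇒GridStep v b vb
    with refl , refl ← gridMove-injective s i s′ i′ (LeaperMove-unique (gridMove s i) (gridMove s′ i′)
                          (fold-GridStep s i u va v∈ a∈)
                          (subst (LeaperMove (gridMove s′ i′) (fold u v)) (sym fa≡fb) (fold-GridStep s′ i′ u vb v∈ b∈)))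
    = GridStep-functional s i va vb

  lift : ∀ m u → Pseudosnake (LeaperAdj p q) (InBoard n) → Pseudosnake GridAdj (InCube m)
  lift m u S = pullback _≟Cell_ (fold u) S (cube 4 m) (cube-unique 4 m) (All.tabulate ∈-cube⁻)
                        (λ {v} {a} → fold-adj u {v} {a}) (λ {v} {a} {b} → fold-locally-injective u {v} {a} {b})

  fold-onto : ∀ x {c} → InBoard P c → ∃ λ u → u ∈ board P × fold u x ≡ c
  fold-onto x (c₁<P , c₂<P)
    with u₁ , u₁<P , hit₁ ← translation-onto (w₁ · x) c₁<P
       | u₂ , u₂<P , hit₂ ← translation-onto (w₂ · x) c₂<P
    = (u₁ , u₂) , ∈-board⁺ (u₁<P , u₂<P) , cong₂ _,_ hit₁ hit₂

  lift-bound : ∀ m g (S : Pseudosnake (LeaperAdj p q) (InBoard n)) →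
               (∀ u → length (Pseudosnake.cells (lift m u S)) ≤ g) →
               m ^ 4 * length (Pseudosnake.cells S) ≤ P * P * g
  lift-bound m g S lift≤g = begin
    m ^ 4 * length cells
      ≡⟨ cong (_* length cells) (length-cube 4 m) ⟨
    length (cube 4 m) * length cells
      ≤⟨ averaging _≟Cell_ fold (board P) (cube 4 m) distinct
           (λ x c∈ → fold-onto x (InBoard-mono (All.lookup inS c∈))) ⟩
    sum (map (λ u → length (filter (λ x → fold u x ∈? cells) (cube 4 m))) (board P))
      ≤⟨ sum-map-≤ _ (board P) lift≤g ⟩
    length (board P) * g
      ≡⟨ cong (_* g) (length-board P) ⟩
    P * P * g
      ∎
    where
    open ≤-Reasoning
    open Pseudosnake S
    InBoard-mono : ∀ {c} → InBoard n c → InBoard P c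
    InBoard-mono (c₁<n , c₂<n) = <-≤-trans c₁<n n≤P , <-≤-trans c₂<n n≤P
      where
      n≤P : n ≤ P
      n≤P = ≤-trans (m≤m+n n q) n+q≤P

gridPseudosnakeSize≤m^4 : ∀ m g → IsMaxPseudosnakeSize GridAdj (InCube m) g → g ≤ m ^ 4
gridPseudosnakeSize≤m^4 m g ((G , refl) , _) =
  subst (length (Pseudosnake.cells G) ≤_) (length-cube 4 m) (length-pseudosnake≤ G ∈-cube⁺)

leaper≤grid : ∀ {p q} → 0 < p → p < q → ∀ n m s g →
              IsMaxPseudosnakeSize (LeaperAdj p q) (InBoard n) s → IsMaxPseudosnakeSize GridAdj (InCube m) g →
              m ^ 4 * s ≤ (n + q) * (n + q) * g
leaper≤grid {p} {q} 0<p p<q n m s g ((S , refl) , _) (_ , maximal) =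
  lift-bound m g S (λ u → maximal (lift m u S))
  where
  instance
    n+q-nonZero : NonZero (n + q)
    n+q-nonZero = >-nonZero (<-≤-trans (<-trans 0<p p<q) (m≤n+m q n))
  open Lifting 0<p p<q {n} {n + q} ≤-refl

lower-density-bound : ∀ d n s → n * n ≤ 2 * s → d * n ^ 2 ≤ 2 * d * s + 2 * n ^ 2
lower-density-bound d n s n²≤2s = begin
  d * n ^ 2        ≡⟨ cong (λ t → d * (n * t)) (*-identityʳ n) ⟩
  d * (n * n)      ≤⟨ *-monoʳ-≤ d n²≤2s ⟩
  d * (2 * s)      ≡⟨ *-assoc d 2 s ⟨
  d * 2 * s        ≡⟨ cong (_* s) (*-comm d 2) ⟩
  2 * d * s        ≤⟨ m≤m+n (2 * d * s) (2 * n ^ 2) ⟩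
  2 * d * s + 2 * n ^ 2 ∎
  where open ≤-Reasoning

private
  expand : ∀ d n q g → d * ((n + q) * (n + q) * g) ≡ d * g * (n * (n * 1)) + g * (d * (2 * n * q + q * q))
  expand = solve-∀
  rearrange : ∀ a n → a * (n * n) ≡ n * (n * 1) * a
  rearrange = solve-∀
  factor : ∀ d n q → d * (2 * n * q + n * (q * q)) ≡ n * (d * (2 * q + q * q))
  factor = solve-∀

upper-density-bound : ∀ d n q a s g → d * (2 * q + q * q) < n → g ≤ a → a * s ≤ (n + q) * (n + q) * g →
                      d * s * a ≤ d * g * n ^ 2 + n ^ 2 * a
upper-density-bound d n@(suc _) q a s g dq<n g≤a a*s≤ = begin
  d * s * a                                      ≡⟨ trans (*-assoc d s a) (cong (d *_) (*-comm s a)) ⟩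
  d * (a * s)                                    ≤⟨ *-monoʳ-≤ d a*s≤ ⟩
  d * ((n + q) * (n + q) * g)                    ≡⟨ expand d n q g ⟩
  d * g * n ^ 2 + g * (d * (2 * n * q + q * q))  ≤⟨ +-monoʳ-≤ (d * g * n ^ 2) (*-mono-≤ g≤a cross≤n²) ⟩
  d * g * n ^ 2 + a * (n * n)                    ≡⟨ cong (d * g * n ^ 2 +_) (rearrange a n) ⟩
  d * g * n ^ 2 + n ^ 2 * a                      ∎
  where
  open ≤-Reasoning
  cross≤n² : d * (2 * n * q + q * q) ≤ n * n
  cross≤n² = begin
    d * (2 * n * q + q * q)      ≤⟨ *-monoʳ-≤ d (+-monoʳ-≤ (2 * n * q) (m≤n*m (q * q) n)) ⟩
    d * (2 * n * q + n * (q * q)) ≡⟨ factor d n q ⟩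
    n * (d * (2 * q + q * q))    ≤⟨ *-monoʳ-≤ n (<⇒≤ dq<n) ⟩
    n * n                        ∎

proposition5 : (p q : ℕ) → SkewFree p q →
    ((d : ℕ) → d ≥ 1 → Σ ℕ λ N → (n s : ℕ) → n ≥ N →
       IsMaxPseudosnakeSize (LeaperAdj p q) (InBoard n) s →
       d * n ^ 2 ≤ 2 * d * s + 2 * n ^ 2)
    ×
    ((d : ℕ) → d ≥ 1 → Σ ℕ λ N → (n m s g : ℕ) → n ≥ N → m ≥ N →
       IsMaxPseudosnakeSize (LeaperAdj p q) (InBoard n) s →
       IsMaxPseudosnakeSize GridAdj (InCube m) g →
       d * s * m ^ 4 ≤ d * g * n ^ 2 + n ^ 2 * m ^ 4)
proposition5 p q (0<p , p<q , _ , p+q-odd) =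
  (λ d _ → 0 , λ n s _ s-max → lower-density-bound d n s (board≤2*pseudosnake n s s-max)) ,
  (λ d _ → suc (d * (2 * q + q * q)) , λ n m s g n>dq _ s-max g-max →
     upper-density-bound d n q (m ^ 4) s g n>dq (gridPseudosnakeSize≤m^4 m g g-max)
                         (leaper≤grid 0<p p<q n m s g s-max g-max))
  where open Colouring {p} {q} p+q-odd
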